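{- Let $I$ be a well-ordered set and $S\subseteq \prod_{i\in I}\{0,1\}$. If $\operatorname{ev}_S(P)$ spans $C(S,\mathbb{Z})$ as an abelian group, then $\operatorname{ev}_S(E(S))$ spans $C(S,\mathbb{Z})$.
   Context: $\prod_{i\in I}\{0,1\}$ has the product topology, $S$ the subspace topology, $x_i$ denotes the $i$-th coordinate. For $i\in I$, $e_{S,i}\in C(S,\mathbb{Z})$ is $x\mapsto x_i$. $P$ is the set of finite strictly decreasing sequences in $I$ (including the empty one), ordered lexicographically (empty sequence smallest; compare first entries, and if equal compare tails). $\operatorname{ev}_S:P\to C(S,\mathbb{Z})$ sends $(i_1,\dots,i_r)$ to $e_{S,i_1}\cdots e_{S,i_r}$. $E(S)=\{p\in P: \operatorname{ev}_S(p)\notin\operatorname{span}_{\mathbb{Z}}\operatorname{ev}_S(\{q\in P:q<p\})\}$. -}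

module Defs where

open import Data.Bool using (Bool; true; false)
open import Data.Integer using (ℤ; _+_; _*_; +_)
open import Data.List using (List; []; _∷_; foldr)
open import Data.List.Membership.Propositional using (_∈_)
open import Data.List.Relation.Unary.All using (All)
open import Data.List.Relation.Unary.Linked using (Linked)
open import Data.Product using (Σ; ∃; _×_; _,_; proj₁; proj₂)
open import Relation.Binary.PropositionalEquality using (_≡_)
open import Relation.Binary.Structures using (IsStrictTotalOrder)
open import Induction.WellFounded using (WellFounded)
open import Relation.Nullary using (¬_)

record WellOrder (I : Set) (_<_ : I → I → Set) : Set where
  field
    isStrictTotalOrder : IsStrictTotalOrder _≡_ _<_
    wellFounded        : WellFounded _<_

module _ {I : Set} (_<_ : I → I → Set) where

  Point : Set
  Point = I → Bool

  Sub : (Point → Set) → Set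
  Sub S = Σ Point S

  -- Continuity of f : S → ℤ (ℤ discrete, S with subspace of the product
  -- topology): each x ∈ S has a basic open neighbourhood (fixing finitely
  -- many coordinates) on which f is constant.
  Continuous : (S : Point → Set) → (Sub S → ℤ) → Set
  Continuous S f = (x : Sub S) → ∃ λ (F : List I) →
    (y : Sub S) → (∀ {i} → i ∈ F → proj₁ y i ≡ proj₁ x i) → f y ≡ f x

  C : (S : Point → Set) → Set
  C S = Σ (Sub S → ℤ) (Continuous S)

  Decreasing : List I → Set
  Decreasing = Linked (λ a b → b < a)

  P : Set
  P = Σ (List I) Decreasing

  data Lex : List I → List I → Set where
    []<∷  : ∀ {j js} → Lex [] (j ∷ js)
    head< : ∀ {i j is js} → i < j → Lex (i ∷ is) (j ∷ js)
    tail< : ∀ {i j is js} → i ≡ j → Lex is js → Lex (i ∷ is) (j ∷ js)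

  _<P_ : P → P → Set
  p <P q = Lex (proj₁ p) (proj₁ q)

  coord : Bool → ℤ
  coord true  = + 1
  coord false = + 0

  -- ev_S(i₁,…,i_r) = e_{S,i₁} ⋯ e_{S,i_r}  (empty product = 1)
  evList : List I → Point → ℤ
  evList is x = foldr (λ i r → coord (x i) * r) (+ 1) is

  ev : (S : Point → Set) → P → Sub S → ℤ
  ev S p y = evList (proj₁ p) (proj₁ y)

  combo : (S : Point → Set) → List (ℤ × P) → Sub S → ℤ
  combo S cs y = foldr (λ cp r → proj₁ cp * ev S (proj₂ cp) y + r) (+ 0) cs

  InSpan : (S : Point → Set) → (Q : P → Set) → (Sub S → ℤ) → Set
  InSpan S Q g = ∃ λ (cs : List (ℤ × P)) →
    All (λ cp → Q (proj₂ cp)) cs × ((y : Sub S) → g y ≡ combo S cs y)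

  E : (S : Point → Set) → P → Set
  E S p = ¬ InSpan S (λ q → q <P p) (ev S p)

  Spans : (S : Point → Set) → (Q : P → Set) → Set
  Spans S Q = (f : C S) → InSpan S Q (proj₁ f)

{-# OPTIONS --safe #-}
-- Decreasing sequences in a well-founded order are well-founded under the
-- lexicographic order, so we may argue by induction on p ∈ P: either p ∈ E(S),
-- or ev_S(p) is a ℤ-combination of ev_S(q) with q < p, each of which lies in
-- the span of ev_S(E(S)) by induction.  Hence ev_S(P), and with it C(S, ℤ),
-- lies in that span.
module Submission where

open import Defs
open import Data.Unit using (⊤)
open import Axiom.ExcludedMiddle using (ExcludedMiddle)
open import Level using (0ℓ)
open import Data.Integer using (ℤ; _+_; _*_; +_)
open import Data.Integer.Properties
  using (*-assoc; *-distribˡ-+; *-zeroʳ; +-assoc; +-identityˡ; +-identityʳ; *-identityˡ)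
open import Data.List using (List; []; _∷_; _++_; map)
open import Data.List.Relation.Unary.All using (All; []; _∷_)
import Data.List.Relation.Unary.All as All
open import Data.List.Relation.Unary.All.Properties using (map⁺; ++⁺)
open import Data.List.Relation.Unary.Linked using ([]; [-]; _∷_) renaming (tail to Linked-tail)
open import Data.Product using (_×_; _,_; proj₁; proj₂)
open import Relation.Binary.PropositionalEquality using (_≡_; refl; sym; trans; cong; cong₂; module ≡-Reasoning)
open import Induction.WellFounded using (WellFounded; Acc; acc)
open import Relation.Nullary using (yes; no)

module LexWellFounded {I : Set} (_<_ : I → I → Set) where

  private
    _⊏_ : P _<_ → P _<_ → Set
    _⊏_ = _<P_ _<_

  acc-[] : ∀ d → Acc _⊏_ ([] , d)
  acc-[] d = acc λ ()

  acc-∷ : ∀ {i} → Acc _<_ i → ∀ is (d : Decreasing _<_ (i ∷ is)) → Acc _⊏_ (i ∷ is , d)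
  acc-∷ {i} (acc rs) is d = acc-∷-byTail (acc-tail is d) d
    where
      acc-below : ∀ {j} → j < i → ∀ js (d : Decreasing _<_ (j ∷ js)) → Acc _⊏_ (j ∷ js , d)
      acc-below j<i = acc-∷ (rs j<i)

      acc-tail : ∀ is (d : Decreasing _<_ (i ∷ is)) → Acc _⊏_ (is , Linked-tail d)
      acc-tail []       [-]       = acc-[] []
      acc-tail (j ∷ js) (j<i ∷ d) = acc-below j<i js d

      acc-∷-byTail : ∀ {is d′} → Acc _⊏_ (is , d′) → (d : Decreasing _<_ (i ∷ is)) → Acc _⊏_ (i ∷ is , d)
      acc-∷-byTail {is} (acc rsₜ) d = acc below
        where
          below : ∀ {q} → q ⊏ (i ∷ is , d) → Acc _⊏_ q
          below {[]     , dq} []<∷            = acc-[] dq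
          below {j ∷ js , dq} (head< j<i)     = acc-below j<i js dq
          below {_ ∷ js , dq} (tail< refl lt) = acc-∷-byTail (rsₜ {js , Linked-tail dq} lt) dq

  <P-wellFounded : WellFounded _<_ → WellFounded _⊏_
  <P-wellFounded wf ([]     , d) = acc-[] d
  <P-wellFounded wf (i ∷ is , d) = acc-∷ (wf i) is d

module Span {I : Set} (_<_ : I → I → Set) (S : Point _<_ → Set) where

  private
    Combination : Set
    Combination = List (ℤ × P _<_)

    ∑ : Combination → Sub _<_ S → ℤ
    ∑ = combo _<_ S

  scale : ℤ → Combination → Combination
  scale c = map (λ cp → c * proj₁ cp , proj₂ cp)

  combo-scale : ∀ c cs y → ∑ (scale c cs) y ≡ c * ∑ cs y
  combo-scale c []             y = sym (*-zeroʳ c)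
  combo-scale c ((d , p) ∷ cs) y = begin
    c * d * ev _<_ S p y + ∑ (scale c cs) y     ≡⟨ cong₂ _+_ (*-assoc c d _) (combo-scale c cs y) ⟩
    c * (d * ev _<_ S p y) + c * ∑ cs y         ≡⟨ sym (*-distribˡ-+ c _ _) ⟩
    c * (d * ev _<_ S p y + ∑ cs y)             ∎
    where open ≡-Reasoning

  combo-++ : ∀ cs ds y → ∑ (cs ++ ds) y ≡ ∑ cs y + ∑ ds y
  combo-++ []             ds y = sym (+-identityˡ _)
  combo-++ ((c , p) ∷ cs) ds y = begin
    c * ev _<_ S p y + ∑ (cs ++ ds) y           ≡⟨ cong (_+_ (c * ev _<_ S p y)) (combo-++ cs ds y) ⟩
    c * ev _<_ S p y + (∑ cs y + ∑ ds y)        ≡⟨ sym (+-assoc (c * ev _<_ S p y) (∑ cs y) (∑ ds y)) ⟩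
    c * ev _<_ S p y + ∑ cs y + ∑ ds y          ∎
    where open ≡-Reasoning

  InSpan-ev : ∀ {Q : P _<_ → Set} {p} → Q p → InSpan _<_ S Q (ev _<_ S p)
  InSpan-ev qp = (+ 1 , _) ∷ [] , qp ∷ [] , λ y → sym (trans (+-identityʳ _) (*-identityˡ _))

  InSpan-combo : ∀ {Q : P _<_ → Set} (cs : Combination) →
                 All (λ cp → InSpan _<_ S Q (ev _<_ S (proj₂ cp))) cs →
                 InSpan _<_ S Q (∑ cs)
  InSpan-combo []             []                        = [] , [] , λ y → refl
  InSpan-combo ((c , p) ∷ cs) ((ds , ds⊆Q , ev≡) ∷ rest) with InSpan-combo cs rest
  ... | es , es⊆Q , ∑cs≡ = scale c ds ++ es , ++⁺ (map⁺ ds⊆Q) es⊆Q , λ y → begin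
    c * ev _<_ S p y + ∑ cs y                   ≡⟨ cong₂ _+_ (cong (c *_) (ev≡ y)) (∑cs≡ y) ⟩
    c * ∑ ds y + ∑ es y                         ≡⟨ cong (_+ ∑ es y) (sym (combo-scale c ds y)) ⟩
    ∑ (scale c ds) y + ∑ es y                   ≡⟨ sym (combo-++ (scale c ds) es y) ⟩
    ∑ (scale c ds ++ es) y                      ∎
    where open ≡-Reasoning

  InSpan-trans : ∀ {Q Q′ : P _<_ → Set} {g} →
                 (∀ {p} → Q p → InSpan _<_ S Q′ (ev _<_ S p)) →
                 InSpan _<_ S Q g → InSpan _<_ S Q′ g
  InSpan-trans ev∈Q′ (cs , cs⊆Q , g≡) with InSpan-combo cs (All.map ev∈Q′ cs⊆Q)
  ... | ds , ds⊆Q′ , ∑cs≡ = ds , ds⊆Q′ , λ y → trans (g≡ y) (∑cs≡ y)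

  ev-InSpan-E : ExcludedMiddle 0ℓ → WellFounded _<_ → ∀ p → InSpan _<_ S (E _<_ S) (ev _<_ S p)
  ev-InSpan-E em wf p = go p (LexWellFounded.<P-wellFounded _<_ wf p)
    where
      go : ∀ p → Acc (_<P_ _<_) p → InSpan _<_ S (E _<_ S) (ev _<_ S p)
      go p (acc rs) with em {InSpan _<_ S (λ q → _<P_ _<_ q p) (ev _<_ S p)}
      ... | no  p∈E   = InSpan-ev {p = p} p∈E
      ... | yes below = InSpan-trans (λ {q} q<p → go q (rs q<p)) below

lemma4p9 : ExcludedMiddle 0ℓ →
    (I : Set) (_<_ : I → I → Set) → WellOrder I _<_ →
    (S : Point _<_ → Set) →
    Spans _<_ S (λ _ → ⊤) →
    Spans _<_ S (E _<_ S)
lemma4p9 em I _<_ wo S P-spans f =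
  InSpan-trans (λ {p} _ → ev-InSpan-E em (WellOrder.wellFounded wo) p) (P-spans f)
  where open Span _<_ S
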